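{- For every connected graph $G$ and non-negative integers $p$ and $s$, the following are equivalent: (1) $G$ has a graph with $p$ vertices and diameter at most $s$ as a contraction; (2) $G$ has a graph with $p$ vertices and diameter at most $s$ as an induced minor; (3) $G$ has a graph with $p$ vertices and diameter at most $s$ as a minor.
   Context: All graphs are finite, simple and undirected. Contracting an edge $uv$ removes $u,v$ and adds a new vertex adjacent to exactly the vertices that were adjacent to $u$ or $v$. $H$ is a contraction of $G$ if $H$ can be obtained from $G$ by edge contractions; an induced minor if obtainable by vertex deletions and edge contractions; a minor if obtainable by vertex deletions, edge deletions and edge contractions. The diameter of a graph is the maximum distance between two of its vertices (infinite for disconnected graphs). -}

module Defs where

open import Data.Nat using (ℕ; zero; suc; _≤_; z≤n; s≤s)
open import Data.Fin using (Fin; zero; suc; _≟_; punchIn)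
open import Data.Bool using (Bool; true; false; if_then_else_; _∧_; _∨_; not)
open import Data.Bool.Properties using (∨-comm)
open import Data.Product using (Σ; ∃-syntax; _×_; _,_)
open import Relation.Nullary using (yes; no; ¬_)
open import Relation.Nullary.Decidable using (⌊_⌋)
open import Relation.Binary.PropositionalEquality using (_≡_; refl; sym; trans)
open import Function.Bundles using (_↔_; Inverse)
open import Data.Empty using (⊥-elim)

_==_ : ∀ {n} → Fin n → Fin n → Bool
x == y = ⌊ x ≟ y ⌋

-- Finite simple graphs.  Convention: a graph has a NON-EMPTY vertex set;
-- the vertex set of a graph with  k = k  is  Fin (suc k)  (order suc k).

record Graph : Set where
  constructor mkGraph
  field
    k       : ℕ
    adj     : Fin (suc k) → Fin (suc k) → Bool
    adj-sym : ∀ x y → adj x y ≡ adj y x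
    adj-irr : ∀ x → adj x x ≡ false

  order : ℕ
  order = suc k

  V : Set
  V = Fin (suc k)

open Graph public

simp : ∀ {n} → (Fin n → Fin n → Bool) → Fin n → Fin n → Bool
simp R x y = if x == y then false else (R x y ∨ R y x)

simp-sym : ∀ {n} (R : Fin n → Fin n → Bool) x y → simp R x y ≡ simp R y x
simp-sym R x y with x ≟ y | y ≟ x
... | yes _ | yes _ = refl
... | yes p | no q = ⊥-elim (q (sym p))
... | no q | yes p = ⊥-elim (q (sym p))
... | no _ | no _ = ∨-comm (R x y) (R y x)

simp-irr : ∀ {n} (R : Fin n → Fin n → Bool) x → simp R x x ≡ false
simp-irr R x with x ≟ x
... | yes _ = refl
... | no q = ⊥-elim (q refl)

fromRel : (k : ℕ) → (Fin (suc k) → Fin (suc k) → Bool) → Graph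
fromRel k R = mkGraph k (simp R) (simp-sym R) (simp-irr R)

-- Delete vertex v (only allowed when G has at least two vertices, so that
-- the result is non-empty).  Remaining vertices are indexed via punchIn v.
deleteVertex : (G : Graph) → 1 ≤ k G → V G → Graph
deleteVertex (mkGraph zero a _ _) () v
deleteVertex (mkGraph (suc j) a _ _) _ v =
  fromRel j (λ x y → a (punchIn v x) (punchIn v y))

deleteEdge : (G : Graph) → V G → V G → Graph
deleteEdge G u v =
  fromRel (k G) (λ x y → adj G x y ∧ not ((x == u ∧ y == v) ∨ (x == v ∧ y == u)))

-- Contract the edge uv: u and v are removed and a new vertex is added that is
-- adjacent exactly to the vertices adjacent to u or to v.  Concretely v is
-- removed (remaining vertices indexed via punchIn v) and the vertex that was u
-- plays the role of the new vertex.
contract : (G : Graph) (u v : V G) → adj G u v ≡ true → Graph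
contract (mkGraph zero a s i) zero zero e with trans (sym (i zero)) e
... | ()
contract (mkGraph (suc j) a s i) u v e = fromRel j R
  where
  f : Fin (suc j) → Fin (suc (suc j))
  f = punchIn v
  R : Fin (suc j) → Fin (suc j) → Bool
  R x y = a (f x) (f y) ∨ ((f x == u ∧ a v (f y)) ∨ (f y == u ∧ a (f x) v))

record _≅_ (H G : Graph) : Set where
  field
    bij      : V H ↔ V G
    preserve : ∀ x y → adj H x y ≡ adj G (Inverse.to bij x) (Inverse.to bij y)

data IsContractionOf (H : Graph) : Graph → Set where
  done  : ∀ {G} → H ≅ G → IsContractionOf H G
  contr : ∀ {G} (u v : V G) (e : adj G u v ≡ true) →
          IsContractionOf H (contract G u v e) → IsContractionOf H G

data IsInducedMinorOf (H : Graph) : Graph → Set where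
  done  : ∀ {G} → H ≅ G → IsInducedMinorOf H G
  contr : ∀ {G} (u v : V G) (e : adj G u v ≡ true) →
          IsInducedMinorOf H (contract G u v e) → IsInducedMinorOf H G
  delV  : ∀ {G} (h : 1 ≤ k G) (v : V G) →
          IsInducedMinorOf H (deleteVertex G h v) → IsInducedMinorOf H G

data IsMinorOf (H : Graph) : Graph → Set where
  done  : ∀ {G} → H ≅ G → IsMinorOf H G
  contr : ∀ {G} (u v : V G) (e : adj G u v ≡ true) →
          IsMinorOf H (contract G u v e) → IsMinorOf H G
  delV  : ∀ {G} (h : 1 ≤ k G) (v : V G) →
          IsMinorOf H (deleteVertex G h v) → IsMinorOf H G
  delE  : ∀ {G} (u v : V G) → adj G u v ≡ true →
          IsMinorOf H (deleteEdge G u v) → IsMinorOf H G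

data Walk (G : Graph) : V G → V G → ℕ → Set where
  nil  : ∀ {x} → Walk G x x 0
  cons : ∀ {x y z l} → adj G x y ≡ true → Walk G y z l → Walk G x z (suc l)

Connected : Graph → Set
Connected G = ∀ (x y : V G) → ∃[ l ] Walk G x y l

DiameterAtMost : Graph → ℕ → Set
DiameterAtMost G s = ∀ (x y : V G) → ∃[ l ] (l ≤ s × Walk G x y l)

module Submission where

-- Contractions are induced minors and induced minors are minors, so only the
-- passage from a minor back to a contraction needs work.  A minor H of G is
-- witnessed by a model: disjoint, connected, non-empty branch sets in G, one
-- per vertex of H, with an edge of G between the branch sets of adjacent
-- vertices of H.  While G is larger than H some edge of G can be contracted
-- without destroying the model: either an edge inside a branch set, or, since
-- G is connected, an edge joining a vertex outside all branch sets to one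
-- inside.  When no such edge is left every branch set is a single vertex and
-- they cover G, so G is H with possibly extra edges; it has the order of H and
-- extra edges can only shorten distances, so its diameter is at most that of H.

open import Defs
open import Data.Nat using (ℕ; zero; suc; _≤_; _<_; s≤s)
open import Data.Nat.Properties using (n<1+n)
open import Data.Fin using (Fin; zero; suc; punchIn; punchOut; _≟_)
open import Data.Fin.Properties
  using (punchIn-injective; punchInᵢ≢i; punchIn-punchOut; any?; cantor-schröder-bernstein)
open import Data.Maybe using (Maybe; just; nothing; _>>=_)
open import Data.Maybe.Properties using (just-injective) renaming (≡-dec to ≡-dec-Maybe)
open import Data.Bool using (Bool; true; false; _∧_; _∨_; not)
open import Data.Bool.Properties using (∨-zeroʳ; ∧-conicalˡ; ∧-conicalʳ)
open import Data.Product using (∃-syntax; _×_; _,_; proj₁; proj₂)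
open import Data.Sum using (_⊎_; inj₁; inj₂; [_,_]; map₁)
open import Data.Empty using (⊥-elim)
open import Data.Unit using (⊤; tt)
open import Function using (_∘_; id)
open import Relation.Nullary using (¬_; yes; no)
open import Relation.Nullary.Decidable using (_×-dec_; ¬?)
open import Relation.Binary.PropositionalEquality using (_≡_; _≢_; refl; sym; trans; cong; subst; subst₂)
open import Relation.Binary.Construct.Closure.ReflexiveTransitive using (Star; ε; _◅_; _◅◅_; gmap)
open import Function.Bundles using (_⇔_; Inverse; mk⇔)
open import Function.Properties.Inverse using (↔-refl)

∨-trueˡ : ∀ {x} y → x ≡ true → x ∨ y ≡ true
∨-trueˡ y refl = refl

∨-trueʳ : ∀ x {y} → y ≡ true → x ∨ y ≡ true
∨-trueʳ x refl = ∨-zeroʳ x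

∨-true-split : ∀ x {y} → x ∨ y ≡ true → x ≡ true ⊎ y ≡ true
∨-true-split true  _ = inj₁ refl
∨-true-split false p = inj₂ p

∧-true : ∀ {x y} → x ≡ true → y ≡ true → x ∧ y ≡ true
∧-true refl refl = refl

≡⇒== : ∀ {n} {x y : Fin n} → x ≡ y → (x == y) ≡ true
≡⇒== {x = x} {y} x≡y with x ≟ y
... | yes _   = refl
... | no x≢y = ⊥-elim (x≢y x≡y)

==⇒≡ : ∀ {n} {x y : Fin n} → (x == y) ≡ true → x ≡ y
==⇒≡ {x = x} {y} p with x ≟ y
... | yes x≡y = x≡y

R⇒simp : ∀ {n} (R : Fin n → Fin n → Bool) {x y} → x ≢ y → R x y ≡ true → simp R x y ≡ true
R⇒simp R {x} {y} x≢y r with x ≟ y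
... | yes x≡y = ⊥-elim (x≢y x≡y)
... | no _    = ∨-trueˡ (R y x) r

simp⇒R : ∀ {n} (R : Fin n → Fin n → Bool) {x y} → simp R x y ≡ true → R x y ≡ true ⊎ R y x ≡ true
simp⇒R R {x} {y} p with x ≟ y
... | no _ = ∨-true-split (R x y) p

adj⇒≢ : (G : Graph) {x y : V G} → adj G x y ≡ true → x ≢ y
adj⇒≢ G {x} p refl with trans (sym (adj-irr G x)) p
... | ()

EdgeIn : (G : Graph) → (V G → Set) → V G → V G → Set
EdgeIn G P x y = P x × P y × adj G x y ≡ true

PathIn : (G : Graph) → (V G → Set) → V G → V G → Set
PathIn G P = Star (EdgeIn G P)

PathConnected : Graph → Set
PathConnected G = ∀ x y → PathIn G (λ _ → ⊤) x y

walk⇒path : ∀ {G : Graph} {x y l} → Walk G x y l → PathIn G (λ _ → ⊤) x y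
walk⇒path nil         = ε
walk⇒path (cons p xs) = (tt , tt , p) ◅ walk⇒path xs

connected⇒pathConnected : ∀ {G} → Connected G → PathConnected G
connected⇒pathConnected conn x y = walk⇒path (proj₂ (conn x y))

-- The branch set of a ∈ V H is the fibre of just a; vertices of G mapped to
-- nothing lie in no branch set.
record MinorModel (H G : Graph) : Set where
  field
    branch           : V G → Maybe (V H)
    branch-nonempty  : ∀ a → ∃[ x ] branch x ≡ just a
    branch-adjacent  : ∀ a b → adj H a b ≡ true →
                       ∃[ x ] ∃[ y ] (branch x ≡ just a × branch y ≡ just b × adj G x y ≡ true)
    branch-connected : ∀ a {x y} → branch x ≡ just a → branch y ≡ just a →
                       PathIn G (λ w → branch w ≡ just a) x y
open MinorModel

identity-model : (G : Graph) → MinorModel G G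
identity-model G = record
  { branch           = just
  ; branch-nonempty  = λ a → a , refl
  ; branch-adjacent  = λ a b p → a , b , refl , refl , p
  ; branch-connected = λ { a refl refl → ε }
  }

record Embedding (G′ G : Graph) : Set where
  field
    embed          : V G′ → V G
    preimage       : V G → Maybe (V G′)
    preimage-embed : ∀ x → preimage (embed x) ≡ just x
    embed-preimage : ∀ {w x} → preimage w ≡ just x → embed x ≡ w
    embed-adj      : ∀ {x y} → adj G′ x y ≡ true → adj G (embed x) (embed y) ≡ true

module _ {H G′ G : Graph} (φ : Embedding G′ G) (m : MinorModel H G′) where
  open Embedding φ

  private
    branchᴳ : V G → Maybe (V H)
    branchᴳ w = preimage w >>= branch m

    branchᴳ-embed : ∀ x → branchᴳ (embed x) ≡ branch m x
    branchᴳ-embed x = cong (_>>= branch m) (preimage-embed x)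

    branchᴳ-just : ∀ {w a} → branchᴳ w ≡ just a → ∃[ x ] (embed x ≡ w × branch m x ≡ just a)
    branchᴳ-just {w} p with preimage w in eq
    ... | just x = x , embed-preimage eq , p

    path-embed : ∀ {a x y} → PathIn G′ (λ w → branch m w ≡ just a) x y →
                 PathIn G (λ w → branchᴳ w ≡ just a) (embed x) (embed y)
    path-embed = gmap embed λ (px , py , axy) →
      trans (branchᴳ-embed _) px , trans (branchᴳ-embed _) py , embed-adj axy

  embedding-transfer : MinorModel H G
  embedding-transfer = record
    { branch           = branchᴳ
    ; branch-nonempty  = λ a → let (x , p) = branch-nonempty m a in embed x , trans (branchᴳ-embed x) p
    ; branch-adjacent  = λ a b h →
        let (x , y , px , py , axy) = branch-adjacent m a b h in
        embed x , embed y , trans (branchᴳ-embed x) px , trans (branchᴳ-embed y) py , embed-adj axy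
    ; branch-connected = connected
    }
    where
    connected : ∀ a {x y} → branchᴳ x ≡ just a → branchᴳ y ≡ just a →
                PathIn G (λ w → branchᴳ w ≡ just a) x y
    connected a px py with branchᴳ-just px | branchᴳ-just py
    ... | x , refl , px′ | y , refl , py′ = path-embed (branch-connected m a px′ py′)

≅⇒embedding : ∀ {H G} → H ≅ G → Embedding H G
≅⇒embedding {H} {G} H≅G = record
  { embed          = to
  ; preimage       = just ∘ from
  ; preimage-embed = λ x → cong just (inverseʳ refl)
  ; embed-preimage = λ p → inverseˡ (sym (just-injective p))
  ; embed-adj      = λ {x} {y} p → trans (sym (preserve x y)) p
  }
  where
  open _≅_ H≅G
  open Inverse bij

deleteEdge-embedding : (G : Graph) (u v : V G) → Embedding (deleteEdge G u v) G
deleteEdge-embedding G u v = record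
  { embed          = id
  ; preimage       = just
  ; preimage-embed = λ x → refl
  ; embed-preimage = λ p → sym (just-injective p)
  ; embed-adj      = adj⇒adj
  }
  where
  adj⇒adj : ∀ {x y} → adj (deleteEdge G u v) x y ≡ true → adj G x y ≡ true
  adj⇒adj {x} {y} p with simp⇒R (λ x y → adj G x y ∧ not ((x == u ∧ y == v) ∨ (x == v ∧ y == u))) p
  ... | inj₁ r = ∧-conicalˡ (adj G x y) _ r
  ... | inj₂ r = trans (adj-sym G x y) (∧-conicalˡ (adj G y x) _ r)

punchIn-preimage : ∀ {n} → Fin (suc n) → Fin (suc n) → Maybe (Fin n)
punchIn-preimage v w with v ≟ w
... | yes _   = nothing
... | no v≢w = just (punchOut v≢w)

punchIn-preimage-punchIn : ∀ {n} (v : Fin (suc n)) x → punchIn-preimage v (punchIn v x) ≡ just x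
punchIn-preimage-punchIn v x with v ≟ punchIn v x
... | yes v≡vx = ⊥-elim (punchInᵢ≢i v x (sym v≡vx))
... | no v≢vx  = cong just (punchIn-injective v _ _ (punchIn-punchOut v≢vx))

punchIn-preimage-just : ∀ {n} (v w : Fin (suc n)) {x} → punchIn-preimage v w ≡ just x → punchIn v x ≡ w
punchIn-preimage-just v w p with v ≟ w
punchIn-preimage-just v w refl | no v≢w = punchIn-punchOut v≢w

deleteVertex-embedding : (G : Graph) (h : 1 ≤ k G) (v : V G) → Embedding (deleteVertex G h v) G
deleteVertex-embedding (mkGraph (suc j) a sy ir) _ v = record
  { embed          = punchIn v
  ; preimage       = punchIn-preimage v
  ; preimage-embed = punchIn-preimage-punchIn v
  ; embed-preimage = punchIn-preimage-just v _
  ; embed-adj      = λ p → [ id , trans (sy _ _) ] (simp⇒R (λ x y → a (punchIn v x) (punchIn v y)) p)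
  }

-- A model may be pushed through the contraction of uv, which keeps u and
-- deletes v, when v lies in no branch set or in the branch set of u.
SafeToContract : ∀ {H G} → MinorModel H G → V G → V G → Set
SafeToContract m u v = branch m v ≡ nothing ⊎ branch m u ≡ branch m v

module Contraction (j : ℕ) (a : Fin (suc (suc j)) → Fin (suc (suc j)) → Bool)
                   (sy : ∀ x y → a x y ≡ a y x) (ir : ∀ x → a x x ≡ false)
                   (u v : Fin (suc (suc j))) (e : a u v ≡ true) where

  G : Graph
  G = mkGraph (suc j) a sy ir

  G′ : Graph
  G′ = contract G u v e

  private
    R : Fin (suc j) → Fin (suc j) → Bool
    R x y = a (punchIn v x) (punchIn v y)
          ∨ ((punchIn v x == u ∧ a v (punchIn v y)) ∨ (punchIn v y == u ∧ a (punchIn v x) v))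

    u≢v : u ≢ v
    u≢v = adj⇒≢ G e

  merge : V G → V G′
  merge w with v ≟ w
  ... | yes _   = punchOut (u≢v ∘ sym)
  ... | no v≢w = punchOut v≢w

  MergeSpec : V G → Set
  MergeSpec w = (v ≡ w × punchIn v (merge w) ≡ u) ⊎ (v ≢ w × punchIn v (merge w) ≡ w)

  merge-spec : ∀ w → MergeSpec w
  merge-spec w with v ≟ w
  ... | yes v≡w = inj₁ (v≡w , punchIn-punchOut _)
  ... | no v≢w  = inj₂ (v≢w , punchIn-punchOut v≢w)

  merge-punchIn : ∀ x → merge (punchIn v x) ≡ x
  merge-punchIn x with merge-spec (punchIn v x)
  ... | inj₁ (v≡vx , _) = ⊥-elim (punchInᵢ≢i v x (sym v≡vx))
  ... | inj₂ (_ , eq)   = punchIn-injective v _ _ eq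

  merge-v≡merge-u : merge v ≡ merge u
  merge-v≡merge-u with merge-spec v | merge-spec u
  ... | inj₁ (_ , pv) | inj₂ (_ , pu) = punchIn-injective v _ _ (trans pv (sym pu))
  ... | inj₂ (v≢v , _) | _            = ⊥-elim (v≢v refl)
  ... | _ | inj₁ (v≡u , _)            = ⊥-elim (u≢v (sym v≡u))

  merge-fibre : ∀ {w w′} → merge w ≡ merge w′ → w ≡ w′ ⊎ (w ≡ u × w′ ≡ v) ⊎ (w ≡ v × w′ ≡ u)
  merge-fibre {w} {w′} eq with merge-spec w | merge-spec w′
  ... | inj₁ (p , _) | inj₁ (q , _)  = inj₁ (trans (sym p) q)
  ... | inj₁ (p , h) | inj₂ (_ , h′) = inj₂ (inj₂ (sym p , trans (sym h′) (trans (cong (punchIn v) (sym eq)) h)))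
  ... | inj₂ (_ , h) | inj₁ (q , h′) = inj₂ (inj₁ (trans (sym h) (trans (cong (punchIn v) eq) h′) , sym q))
  ... | inj₂ (_ , h) | inj₂ (_ , h′) = inj₁ (trans (sym h) (trans (cong (punchIn v) eq) h′))

  private
    merge-v≡ : ∀ {x} → (punchIn v x == u) ≡ true → merge v ≡ x
    merge-v≡ {x} p = trans merge-v≡merge-u (trans (cong merge (sym (==⇒≡ p))) (merge-punchIn x))

    R-lift : ∀ x y → R x y ≡ true → ∃[ w ] ∃[ w′ ] (merge w ≡ x × merge w′ ≡ y × a w w′ ≡ true)
    R-lift x y r with ∨-true-split (a (punchIn v x) (punchIn v y)) r
    ... | inj₁ axy = punchIn v x , punchIn v y , merge-punchIn x , merge-punchIn y , axy
    ... | inj₂ r′ with ∨-true-split (punchIn v x == u ∧ a v (punchIn v y)) r′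
    ... | inj₁ r″ = v , punchIn v y , merge-v≡ (∧-conicalˡ _ _ r″) , merge-punchIn y , ∧-conicalʳ _ _ r″
    ... | inj₂ r″ = punchIn v x , v , merge-punchIn x , merge-v≡ (∧-conicalˡ _ _ r″) , ∧-conicalʳ _ _ r″

  adj′-lift : ∀ {x y} → adj G′ x y ≡ true → ∃[ w ] ∃[ w′ ] (merge w ≡ x × merge w′ ≡ y × a w w′ ≡ true)
  adj′-lift {x} {y} p with simp⇒R R p
  ... | inj₁ r = R-lift x y r
  ... | inj₂ r = let (w , w′ , mw , mw′ , aw) = R-lift y x r in w′ , w , mw′ , mw , trans (sy w′ w) aw

  adj-merge : ∀ {w w′} → a w w′ ≡ true → merge w ≢ merge w′ → adj G′ (merge w) (merge w′) ≡ true
  adj-merge {w} {w′} aw ne = R⇒simp R ne (R-merge (merge-spec w) (merge-spec w′))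
    where
    x′ y′ : V G
    x′ = punchIn v (merge w)
    y′ = punchIn v (merge w′)
    a-true : ∀ {x y} → x ≡ w → y ≡ w′ → a x y ≡ true
    a-true refl refl = aw
    R-merge : MergeSpec w → MergeSpec w′ → R (merge w) (merge w′) ≡ true
    R-merge (inj₁ (p , _)) (inj₁ (q , _)) = ⊥-elim (ne (cong merge (trans (sym p) q)))
    R-merge (inj₁ (p , h)) (inj₂ (_ , h′)) =
      ∨-trueʳ (a x′ y′) (∨-trueˡ _ (∧-true (≡⇒== h) (a-true p h′)))
    R-merge (inj₂ (_ , h)) (inj₁ (q , h′)) =
      ∨-trueʳ (a x′ y′) (∨-trueʳ (x′ == u ∧ a v y′) (∧-true (≡⇒== h′) (a-true h q)))
    R-merge (inj₂ (_ , h)) (inj₂ (_ , h′)) = ∨-trueˡ _ (a-true h h′)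

  module _ (P′ : V G′ → Set) where

    path-within-fibre : ∀ {w w′} → merge w ≡ merge w′ → P′ (merge w) → PathIn G (P′ ∘ merge) w w′
    path-within-fibre eq p with merge-fibre eq
    ... | inj₁ refl                 = ε
    ... | inj₂ (inj₁ (refl , refl)) = (p , subst P′ eq p , e) ◅ ε
    ... | inj₂ (inj₂ (refl , refl)) = (p , subst P′ eq p , trans (sy v u) e) ◅ ε

    path-lift : ∀ {x y} → PathIn G′ P′ x y → P′ x → ∀ {w w′} → merge w ≡ x → merge w′ ≡ y →
                PathIn G (P′ ∘ merge) w w′
    path-lift ε px mw mw′ = path-within-fibre (trans mw (sym mw′)) (subst P′ (sym mw) px)
    path-lift ((px′ , py , axy) ◅ rest) px mw mw′ with adj′-lift axy
    ... | z , z′ , mz , mz′ , az =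
      path-within-fibre (trans mw (sym mz)) (subst P′ (sym mw) px) ◅◅
      ((subst P′ (sym mz) px′ , subst P′ (sym mz′) py , az) ◅ path-lift rest py mz′ mw′)

  path-merge : ∀ {P : V G → Set} {P′ : V G′ → Set} → (∀ {w} → P w → P′ (merge w)) →
               ∀ {x y} → PathIn G P x y → PathIn G′ P′ (merge x) (merge y)
  path-merge P⇒P′ ε = ε
  path-merge {P′ = P′} P⇒P′ {x} ((px , py , axy) ◅ rest) with merge x ≟ merge _
  ... | yes eq = subst (λ t → PathIn G′ P′ t _) (sym eq) (path-merge P⇒P′ rest)
  ... | no ne  = (P⇒P′ px , P⇒P′ py , adj-merge axy ne) ◅ path-merge P⇒P′ rest

  pathConnected : PathConnected G → PathConnected G′
  pathConnected conn x y =
    subst₂ (PathIn G′ _) (merge-punchIn x) (merge-punchIn y) (path-merge (λ _ → tt) (conn (punchIn v x) (punchIn v y)))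

  pullback : ∀ {H} → MinorModel H G′ → MinorModel H G
  pullback {H} m = record
    { branch           = branch m ∘ merge
    ; branch-nonempty  = λ b → let (x , p) = branch-nonempty m b in
                                punchIn v x , trans (cong (branch m) (merge-punchIn x)) p
    ; branch-adjacent  = adjacent
    ; branch-connected = λ b px py → path-lift (λ z → branch m z ≡ just b) (branch-connected m b px py) px refl refl
    }
    where
    adjacent : ∀ b b′ → adj H b b′ ≡ true →
               ∃[ x ] ∃[ y ] (branch m (merge x) ≡ just b × branch m (merge y) ≡ just b′ × a x y ≡ true)
    adjacent b b′ h with branch-adjacent m b b′ h
    ... | x , y , px , py , axy with adj′-lift axy
    ... | w , w′ , mw , mw′ , aw = w , w′ , trans (cong (branch m) mw) px , trans (cong (branch m) mw′) py , aw

  module _ {H} (m : MinorModel H G) (safe : SafeToContract m u v) where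

    branch-merge : ∀ {w b} → branch m w ≡ just b → branch m (punchIn v (merge w)) ≡ just b
    branch-merge {w} pw = by-cases w pw (merge-spec w) safe
      where
      by-cases : ∀ w {b} → branch m w ≡ just b → MergeSpec w → SafeToContract m u v →
                 branch m (punchIn v (merge w)) ≡ just b
      by-cases w pw (inj₂ (_ , h)) _ = trans (cong (branch m) h) pw
      by-cases w pw (inj₁ (refl , h)) (inj₁ pv) with trans (sym pv) pw
      ... | ()
      by-cases w pw (inj₁ (refl , h)) (inj₂ puv) = trans (cong (branch m) h) (trans puv pw)

    pushforward : MinorModel H G′
    pushforward = record
      { branch           = branch m ∘ punchIn v
      ; branch-nonempty  = λ b → let (x , p) = branch-nonempty m b in merge x , branch-merge p
      ; branch-adjacent  = adjacent
      ; branch-connected = λ b px py →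
          subst₂ (PathIn G′ _) (merge-punchIn _) (merge-punchIn _)
                 (path-merge branch-merge (branch-connected m b px py))
      }
      where
      adjacent : ∀ b b′ → adj H b b′ ≡ true →
                 ∃[ x ] ∃[ y ] (branch m (punchIn v x) ≡ just b × branch m (punchIn v y) ≡ just b′ × adj G′ x y ≡ true)
      adjacent b b′ h with branch-adjacent m b b′ h
      ... | x , y , px , py , axy = merge x , merge y , branch-merge px , branch-merge py , adj-merge axy distinct
        where
        distinct : merge x ≢ merge y
        distinct eq = adj⇒≢ H h (just-injective
          (trans (sym (branch-merge px)) (trans (cong (branch m ∘ punchIn v) eq) (branch-merge py))))

contract-pullback : ∀ {H} (G : Graph) (u v : V G) (e : adj G u v ≡ true) →
                    MinorModel H (contract G u v e) → MinorModel H G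
contract-pullback (mkGraph zero a sy ir) zero zero e = ⊥-elim (adj⇒≢ (mkGraph zero a sy ir) e refl)
contract-pullback (mkGraph (suc j) a sy ir) u v e = Contraction.pullback j a sy ir u v e

contract-order : (G : Graph) (u v : V G) (e : adj G u v ≡ true) → suc (k (contract G u v e)) ≡ k G
contract-order (mkGraph zero a sy ir) zero zero e = ⊥-elim (adj⇒≢ (mkGraph zero a sy ir) e refl)
contract-order (mkGraph (suc j) a sy ir) u v e = refl

contract-pathConnected : (G : Graph) (u v : V G) (e : adj G u v ≡ true) →
                         PathConnected G → PathConnected (contract G u v e)
contract-pathConnected (mkGraph zero a sy ir) zero zero e = ⊥-elim (adj⇒≢ (mkGraph zero a sy ir) e refl)
contract-pathConnected (mkGraph (suc j) a sy ir) u v e = Contraction.pathConnected j a sy ir u v e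

contract-pushforward : ∀ {H} (G : Graph) (u v : V G) (e : adj G u v ≡ true) (m : MinorModel H G) →
                       SafeToContract m u v → MinorModel H (contract G u v e)
contract-pushforward (mkGraph zero a sy ir) zero zero e = ⊥-elim (adj⇒≢ (mkGraph zero a sy ir) e refl)
contract-pushforward (mkGraph (suc j) a sy ir) u v e = Contraction.pushforward j a sy ir u v e

minor⇒model : ∀ {H G} → IsMinorOf H G → MinorModel H G
minor⇒model (done H≅G)      = embedding-transfer (≅⇒embedding H≅G) (identity-model _)
minor⇒model (contr u v e M) = contract-pullback _ u v e (minor⇒model M)
minor⇒model (delV h v M)    = embedding-transfer (deleteVertex-embedding _ h v) (minor⇒model M)
minor⇒model (delE u v _ M)  = embedding-transfer (deleteEdge-embedding _ u v) (minor⇒model M)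

module _ {H G : Graph} (m : MinorModel H G) where

  Total : Set
  Total = ∀ x → ∃[ a ] branch m x ≡ just a

  SingletonBranches : Set
  SingletonBranches = ∀ {x y a} → branch m x ≡ just a → branch m y ≡ just a → x ≡ y

  SafeEdge : Set
  SafeEdge = ∃[ u ] ∃[ v ] (adj G u v ≡ true × SafeToContract m u v)

  private
    rep : V H → V G
    rep a = proj₁ (branch-nonempty m a)

    branch-rep : ∀ a → branch m (rep a) ≡ just a
    branch-rep a = proj₂ (branch-nonempty m a)

  module _ (total : Total) (singleton : SingletonBranches) where

    private
      label : V G → V H
      label x = proj₁ (total x)

      rep-label : ∀ x → rep (label x) ≡ x
      rep-label x = singleton (branch-rep (label x)) (proj₂ (total x))

      walk-rep : ∀ {a b l} → Walk H a b l → Walk G (rep a) (rep b) l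
      walk-rep nil = nil
      walk-rep {a} (cons {y = b} h rest) with branch-adjacent m a b h
      ... | x , y , px , py , axy =
        cons (subst₂ (λ p q → adj G p q ≡ true) (singleton px (branch-rep a)) (singleton py (branch-rep b)) axy)
             (walk-rep rest)

    bijective-model⇒order≡ : order G ≡ order H
    bijective-model⇒order≡ = cantor-schröder-bernstein {f = label} {g = rep} label-injective rep-injective
      where
      label-injective : ∀ {x y} → label x ≡ label y → x ≡ y
      label-injective {x} {y} eq = trans (sym (rep-label x)) (trans (cong rep eq) (rep-label y))
      rep-injective : ∀ {a b} → rep a ≡ rep b → a ≡ b
      rep-injective {a} {b} eq = just-injective (trans (sym (branch-rep a)) (trans (cong (branch m) eq) (branch-rep b)))

    bijective-model⇒diameter : ∀ {s} → DiameterAtMost H s → DiameterAtMost G s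
    bijective-model⇒diameter diam x y =
      let (l , l≤s , walk) = diam (label x) (label y) in
      l , l≤s , subst₂ (λ p q → Walk G p q l) (rep-label x) (rep-label y) (walk-rep walk)

  unassigned⇒safeEdge : ∀ {x y b} → PathIn G (λ _ → ⊤) x y → branch m x ≡ nothing → branch m y ≡ just b → SafeEdge
  unassigned⇒safeEdge ε px py with trans (sym px) py
  ... | ()
  unassigned⇒safeEdge {x} ((_ , _ , axw) ◅ rest) px py with branch m _ in pw
  ... | nothing = unassigned⇒safeEdge rest pw py
  ... | just _  = _ , x , trans (adj-sym G _ x) axw , inj₁ px

  sharedBranch⇒safeEdge : ∀ {x y a} → x ≢ y → branch m x ≡ just a → branch m y ≡ just a → SafeEdge
  sharedBranch⇒safeEdge x≢y px py with branch-connected m _ px py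
  ... | ε = ⊥-elim (x≢y refl)
  ... | (px′ , pw , axw) ◅ _ = _ , _ , axw , inj₂ (trans px′ (sym pw))

  ¬unassigned⇒total : ¬ (∃[ x ] branch m x ≡ nothing) → Total
  ¬unassigned⇒total none x with branch m x in px
  ... | just a  = a , refl
  ... | nothing = ⊥-elim (none (x , px))

  total⇒singletons⊎safeEdge : Total → SingletonBranches ⊎ SafeEdge
  total⇒singletons⊎safeEdge total
      with any? (λ x → any? (λ y → ¬? (x ≟ y) ×-dec ≡-dec-Maybe _≟_ (branch m x) (branch m y)))
  ... | yes (x , y , x≢y , pxy) =
    inj₂ (sharedBranch⇒safeEdge x≢y (proj₂ (total x)) (trans (sym pxy) (proj₂ (total x))))
  ... | no none-shared = inj₁ singleton
    where
    singleton : SingletonBranches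
    singleton {x} {y} px py with x ≟ y
    ... | yes x≡y = x≡y
    ... | no x≢y  = ⊥-elim (none-shared (x , y , x≢y , trans px (sym py)))

  bijective⊎safeEdge : PathConnected G → (Total × SingletonBranches) ⊎ SafeEdge
  bijective⊎safeEdge conn with any? (λ x → ≡-dec-Maybe _≟_ (branch m x) nothing)
  ... | yes (x , px) = inj₂ (unassigned⇒safeEdge (conn x (rep zero)) px (branch-rep zero))
  ... | no none-unassigned =
    let total = ¬unassigned⇒total none-unassigned in
    map₁ (λ (singleton : SingletonBranches) → total , singleton) (total⇒singletons⊎safeEdge total)

model⇒contraction : ∀ {H s} bound (G : Graph) → k G < bound → PathConnected G → MinorModel H G → DiameterAtMost H s →
                    ∃[ H′ ] (order H′ ≡ order H × DiameterAtMost H′ s × IsContractionOf H′ G)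
model⇒contraction (suc bound) G (s≤s kG≤bound) conn m diam with bijective⊎safeEdge m conn
... | inj₁ (total , singleton) =
  G , bijective-model⇒order≡ m total singleton , bijective-model⇒diameter m total singleton diam ,
  done (record { bij = ↔-refl ; preserve = λ x y → refl })
... | inj₂ (u , v , e , safe)
    with model⇒contraction bound (contract G u v e) (subst (_≤ bound) (sym (contract-order G u v e)) kG≤bound)
           (contract-pathConnected G u v e conn) (contract-pushforward G u v e m safe) diam
... | H′ , order≡ , diam′ , H′≼G′ = H′ , order≡ , diam′ , contr u v e H′≼G′

contraction⇒inducedMinor : ∀ {H G} → IsContractionOf H G → IsInducedMinorOf H G
contraction⇒inducedMinor (done H≅G)      = done H≅G
contraction⇒inducedMinor (contr u v e C) = contr u v e (contraction⇒inducedMinor C)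

inducedMinor⇒minor : ∀ {H G} → IsInducedMinorOf H G → IsMinorOf H G
inducedMinor⇒minor (done H≅G)      = done H≅G
inducedMinor⇒minor (contr u v e M) = contr u v e (inducedMinor⇒minor M)
inducedMinor⇒minor (delV h v M)    = delV h v (inducedMinor⇒minor M)

minor⇒contraction : (G : Graph) → Connected G → (p s : ℕ) →
                    ∃[ H ] (order H ≡ p × DiameterAtMost H s × IsMinorOf H G) →
                    ∃[ H ] (order H ≡ p × DiameterAtMost H s × IsContractionOf H G)
minor⇒contraction G conn p s (H , refl , diam , H≼G) =
  model⇒contraction (suc (k G)) G (n<1+n (k G)) (connected⇒pathConnected conn) (minor⇒model H≼G) diam

lemma7 : (G : Graph) → Connected G → (p s : ℕ) →
    ((∃[ H ] (order H ≡ p × DiameterAtMost H s × IsContractionOf H G))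
      ⇔ (∃[ H ] (order H ≡ p × DiameterAtMost H s × IsInducedMinorOf H G)))
    × ((∃[ H ] (order H ≡ p × DiameterAtMost H s × IsInducedMinorOf H G))
      ⇔ (∃[ H ] (order H ≡ p × DiameterAtMost H s × IsMinorOf H G)))
lemma7 G conn p s =
  mk⇔ (λ (H , o , d , C) → H , o , d , contraction⇒inducedMinor C)
      (λ (H , o , d , M) → minor⇒contraction G conn p s (H , o , d , inducedMinor⇒minor M)) ,
  mk⇔ (λ (H , o , d , M) → H , o , d , inducedMinor⇒minor M)
      (λ (H , o , d , M) → let (H′ , o′ , d′ , C) = minor⇒contraction G conn p s (H , o , d , M)
                           in H′ , o′ , d′ , contraction⇒inducedMinor C)
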